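{- Let $n,a,b,t$ be positive integers with $t\geq 2$, $a\geq b+t$ and $n\geq a+b$. Suppose that $\mathcal{F}\subset\binom{[n]}{a}$ and $\mathcal{G}\subset\binom{[n]}{b}$ are cross-intersecting families with $\tau(\mathcal{G})\geq t$. If $\mathcal{F}=\emptyset$, then \[ |\mathcal{F}|+|\mathcal{G}|\leq \binom{n}{a} + \sum_{i=1}^t(-1)^i\binom{t}{i}\binom{n-ib}{a} + t. \]
   Context: $[n]=\{1,\dots,n\}$ and $\binom{[n]}{k}$ is the family of all $k$-element subsets of $[n]$. Two families $\mathcal{F},\mathcal{G}$ are cross-intersecting if $F\cap G\neq\emptyset$ for all $F\in\mathcal{F}$, $G\in\mathcal{G}$. For a family $\mathcal{G}$ of nonempty subsets of $[n]$, the covering number $\tau(\mathcal{G})$ is the minimum size of a set $T\subset[n]$ with $T\cap G\neq\emptyset$ for all $G\in\mathcal{G}$. Binomial coefficients $\binom{m}{k}$ with $m<k$ are $0$. -}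

module Defs where

open import Data.Nat using (ℕ; zero; suc; _*_; _∸_; _≤_)
open import Data.Nat.Combinatorics using (_C_)
open import Data.Integer as ℤ using (ℤ; +_; -1ℤ)
open import Data.Fin.Subset using (Subset; _∩_; Nonempty; ∣_∣)
open import Data.List using (List)
open import Data.List.Relation.Unary.All using (All)

-- A family of subsets of [n], represented as a list of subsets;
-- duplicate-freeness is imposed separately (Unique) so that length = |family|.
Family : ℕ → Set
Family n = List (Subset n)

Uniform : ∀ {n} → ℕ → Family n → Set
Uniform k 𝓕 = All (λ F → ∣ F ∣ ≡ k) 𝓕
  where open import Relation.Binary.PropositionalEquality using (_≡_)

CrossIntersecting : ∀ {n} → Family n → Family n → Set
CrossIntersecting 𝓕 𝓖 = All (λ F → All (λ G → Nonempty (F ∩ G)) 𝓖) 𝓕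

IsCover : ∀ {n} → Subset n → Family n → Set
IsCover T 𝓖 = All (λ G → Nonempty (T ∩ G)) 𝓖

CoverNumberAtLeast : ∀ {n} → ℕ → Family n → Set
CoverNumberAtLeast {n} t 𝓖 = (T : Subset n) → IsCover T 𝓖 → t ≤ ∣ T ∣

-- altSum n a b t s = Σ_{i=1}^{s} (-1)^i C(t,i) C(n - i b, a)   (truncated ∸ gives C(0,a)=0 as n-ib<a)
altSum : ℕ → ℕ → ℕ → ℕ → ℕ → ℤ
altSum n a b t zero = + 0
altSum n a b t (suc s) =
  altSum n a b t s ℤ.+ (-1ℤ ℤ.^ suc s) ℤ.* (+ (t C suc s)) ℤ.* (+ ((n ∸ suc s * b) C a))

bound : ℕ → ℕ → ℕ → ℕ → ℤ
bound n a b t = + (n C a) ℤ.+ altSum n a b t t ℤ.+ + t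

module Submission where

-- Since 𝓕 = ∅, the cross-intersection and covering hypotheses say nothing and |𝓖| ≤ C(n,b);
-- so it suffices that C(n,b) ≤ H_t(n,a) + t, where
-- H_t(n,c) = C(n,c) + Σ_{i=1}^t (-1)^i C(t,i) C(n-ib,c).
-- H obeys Pascal's rule in (n,c) and H_{t+1}(n,c) = H_t(n,c) - H_t(n-b,c). Together these make
-- H_t(·,c) nondecreasing for t ≤ c, whence H_t(n,c) ≥ C(n,d) for d < b, c ≥ d+t, n ≥ c+d
-- (induction on n from n = c+d, where H_t(c+d,c) = C(c+d,d)). Finally H_t(a+b,a) = C(a+b,b) - t,
-- and Pascal's rule together with the case d = b-1 carries the bound to all n ≥ a+b.

open import Defs
open import Data.Nat using (ℕ; _+_; _≤_; _≥_)
open import Data.Integer as ℤ using (+_)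
open import Data.List using ([]; length)
open import Data.List.Relation.Unary.Unique.Propositional using (Unique)
open import Relation.Binary.PropositionalEquality using (_≡_)

open import Data.Bool using (Bool; true; false; _≟_)
open import Data.Fin.Subset using (Subset; ∣_∣)
open import Data.Integer using (ℤ; -1ℤ; 0ℤ; +≤+; nonNegative)
open import Data.Integer.Properties as ℤ using (pos-+)
open import Data.Integer.Tactic.RingSolver using (solve-∀)
open import Algebra.Properties.AbelianGroup ℤ.+-0-abelianGroup using (//-rightDividesˡ; //-rightDividesʳ)
open import Algebra.Properties.CommutativeSemigroup ℤ.+-commutativeSemigroup using (interchange)
open import Data.List using (_∷_)
open import Data.List.Relation.Unary.All as All using (All; []; _∷_)
open import Data.List.Relation.Unary.AllPairs using ([]; _∷_)
open import Data.Nat using (z<s; suc; zero; _*_; _∸_; _⊓_; _<_; _≤′_; ≤′-refl; ≤′-step; s≤s; z≤n; >-nonZero; NonZero)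
open import Data.Nat.Combinatorics using (_C_; nCk+nC[k+1]≡[n+1]C[k+1]; nCk≡nC[n∸k]; nC1≡n; nCn≡1; k>n⇒nCk≡0)
open import Data.Nat.Properties hiding (_≟_)
open import Data.Vec using ([]; _∷_)
open import Relation.Binary.PropositionalEquality using (_≢_; refl; sym; trans; cong; cong₂; subst; subst₂; module ≡-Reasoning)
open import Relation.Nullary using (yes; no; contradiction)

-- Pascal's rule survives truncated subtraction because the lower index is positive:
-- once k > m both sides vanish.
pascal-∸ : ∀ m k c → (m ∸ k) C suc c + (m ∸ k) C suc (suc c) ≡ (suc m ∸ k) C suc (suc c)
pascal-∸ m       zero    c = nCk+nC[k+1]≡[n+1]C[k+1] m (suc c)
pascal-∸ zero    (suc k) c rewrite 0∸n≡0 k = refl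
pascal-∸ (suc m) (suc k) c = pascal-∸ m k c

m+n∸o<m : ∀ m {n o} .{{_ : NonZero m}} → n < o → m + n ∸ o < m
m+n∸o<m m {n} {o} n<o = m<n+o⇒m∸n<o (m + n) o (subst (m + n <_) (+-comm m o) (+-monoʳ-< m n<o))

m+n≤′[1+m]+[1+n] : ∀ m n → m + n ≤′ suc m + suc n
m+n≤′[1+m]+[1+n] m n = ≤⇒≤′ (+-mono-≤ (n≤1+n m) (n≤1+n n))

[m+n]Cn≡[m+n]Cm : ∀ m n → (m + n) C n ≡ (m + n) C m
[m+n]Cn≡[m+n]Cm m n = trans (nCk≡nC[n∸k] (m≤n+m n m)) (cong ((m + n) C_) (m+n∸n≡m m n))

nCk≤[1+n]Ck : ∀ n k → n C k ≤ suc n C k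
nCk≤[1+n]Ck n zero    = ≤-refl
nCk≤[1+n]Ck n (suc k) = subst (n C suc k ≤_) (nCk+nC[k+1]≡[n+1]C[k+1] n k) (m≤n+m (n C suc k) (n C k))

+nCk+nC[k+1]≡+[n+1]C[k+1] : ∀ n k → + (n C k) ℤ.+ + (n C suc k) ≡ + (suc n C suc k)
+nCk+nC[k+1]≡+[n+1]C[k+1] n k = trans (sym (pos-+ (n C k) (n C suc k))) (cong +_ (nCk+nC[k+1]≡[n+1]C[k+1] n k))

0<t⇒d+t≤c⇒0<c : ∀ {d t c} → 1 ≤ t → d + t ≤ c → 1 ≤ c
0<t⇒d+t≤c⇒0<c {d} {t} 1≤t d+t≤c = ≤-trans (≤-trans 1≤t (m≤n+m t d)) d+t≤c

-- hitting n c t is H_t(n,c); for n ≥ t b, by inclusion–exclusion, it counts the c-subsets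
-- of [n] meeting each of t pairwise disjoint b-subsets.
module Hitting (b : ℕ) where

  term : ℕ → ℕ → ℕ → ℕ → ℤ
  term n c t i = (-1ℤ ℤ.^ i) ℤ.* + (t C i) ℤ.* + ((n ∸ i * b) C c)

  partial : ℕ → ℕ → ℕ → ℕ → ℤ
  partial n c t s = + (n C c) ℤ.+ altSum n c b t s

  hitting : ℕ → ℕ → ℕ → ℤ
  hitting n c t = partial n c t t

  partial-step : ∀ n c t s → partial n c t (suc s) ≡ partial n c t s ℤ.+ term n c t (suc s)
  partial-step n c t s = sym (ℤ.+-assoc (+ (n C c)) (altSum n c b t s) (term n c t (suc s)))

  term-suc : ∀ n c t i → term n c (suc t) (suc i) ≡ term n c t (suc i) ℤ.- term (n ∸ b) c t i
  term-suc n c t i = begin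
    -u ℤ.* + (suc t C suc i) ℤ.* X                 ≡⟨ cong (λ p → -u ℤ.* p ℤ.* X) C-pascal ⟩
    -u ℤ.* (+ (t C i) ℤ.+ + (t C suc i)) ℤ.* X      ≡⟨ expand u (+ (t C i)) (+ (t C suc i)) X ⟩
    -u ℤ.* + (t C suc i) ℤ.* X ℤ.- u ℤ.* + (t C i) ℤ.* X
      ≡⟨ cong (λ x → -u ℤ.* + (t C suc i) ℤ.* X ℤ.- u ℤ.* + (t C i) ℤ.* x) X≡X′ ⟩
    term n c t (suc i) ℤ.- term (n ∸ b) c t i     ∎
    where
    open ≡-Reasoning
    u  = -1ℤ ℤ.^ i
    -u = -1ℤ ℤ.^ suc i
    X  = + ((n ∸ suc i * b) C c)
    X≡X′ : X ≡ + ((n ∸ b ∸ i * b) C c)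
    X≡X′ = cong (λ m → + (m C c)) (sym (∸-+-assoc n b (i * b)))
    C-pascal : + (suc t C suc i) ≡ + (t C i) ℤ.+ + (t C suc i)
    C-pascal = sym (+nCk+nC[k+1]≡+[n+1]C[k+1] t i)
    expand : ∀ u p q x → (-1ℤ ℤ.* u) ℤ.* (p ℤ.+ q) ℤ.* x ≡ (-1ℤ ℤ.* u) ℤ.* q ℤ.* x ℤ.- u ℤ.* p ℤ.* x
    expand = solve-∀

  partial-suc : ∀ n c t s → partial n c (suc t) (suc s) ≡ partial n c t (suc s) ℤ.- partial (n ∸ b) c t s
  partial-suc n c t zero = begin
    partial n c (suc t) 1                                    ≡⟨ partial-step n c (suc t) 0 ⟩
    partial n c t 0 ℤ.+ term n c (suc t) 1                 ≡⟨ cong (ℤ._+_ (partial n c t 0)) (term-suc n c t 0) ⟩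
    partial n c t 0 ℤ.+ (term n c t 1 ℤ.- term (n ∸ b) c t 0)
      ≡⟨ absorb (+ (n C c)) (term n c t 1) (+ ((n ∸ b) C c)) ⟩
    partial n c t 1 ℤ.- partial (n ∸ b) c t 0               ∎
    where
    open ≡-Reasoning
    absorb : ∀ p x y → p ℤ.+ 0ℤ ℤ.+ (x ℤ.- ℤ.1ℤ ℤ.* ℤ.1ℤ ℤ.* y) ≡ (p ℤ.+ (0ℤ ℤ.+ x)) ℤ.- (y ℤ.+ 0ℤ)
    absorb = solve-∀
  partial-suc n c t (suc s) = begin
    partial n c (suc t) (suc (suc s))
      ≡⟨ partial-step n c (suc t) (suc s) ⟩
    partial n c (suc t) (suc s) ℤ.+ term n c (suc t) (suc (suc s))
      ≡⟨ cong₂ ℤ._+_ (partial-suc n c t s) (term-suc n c t (suc s)) ⟩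
    (P ℤ.- Q) ℤ.+ (T ℤ.- S)
      ≡⟨ interchange P (ℤ.- Q) T (ℤ.- S) ⟩
    (P ℤ.+ T) ℤ.+ (ℤ.- Q ℤ.+ ℤ.- S)
      ≡⟨ cong (ℤ._+_ (P ℤ.+ T)) (ℤ.neg-distrib-+ Q S) ⟨
    (P ℤ.+ T) ℤ.- (Q ℤ.+ S)
      ≡⟨ cong₂ ℤ._-_ (partial-step n c t (suc s)) (partial-step (n ∸ b) c t s) ⟨
    partial n c t (suc (suc s)) ℤ.- partial (n ∸ b) c t (suc s) ∎
    where
    open ≡-Reasoning
    P = partial n c t (suc s)
    Q = partial (n ∸ b) c t s
    T = term n c t (suc (suc s))
    S = term (n ∸ b) c t (suc s)

  term-beyond : ∀ n c t {i} → t < i → term n c t i ≡ 0ℤ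
  term-beyond n c t {i} t<i = begin
    (-1ℤ ℤ.^ i) ℤ.* + (t C i) ℤ.* X ≡⟨ cong (λ k → (-1ℤ ℤ.^ i) ℤ.* + k ℤ.* X) (k>n⇒nCk≡0 t<i) ⟩
    (-1ℤ ℤ.^ i) ℤ.* 0ℤ ℤ.* X        ≡⟨ cong (ℤ._* X) (ℤ.*-zeroʳ (-1ℤ ℤ.^ i)) ⟩
    0ℤ ℤ.* X                        ≡⟨ ℤ.*-zeroˡ X ⟩
    0ℤ                              ∎
    where
    open ≡-Reasoning
    X = + ((n ∸ i * b) C c)

  term-small : ∀ n c t i → n ∸ i * b < c → term n c t i ≡ 0ℤ
  term-small n c t i small =
    trans (cong (λ k → (-1ℤ ℤ.^ i) ℤ.* + (t C i) ℤ.* + k) (k>n⇒nCk≡0 small))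
          (ℤ.*-zeroʳ ((-1ℤ ℤ.^ i) ℤ.* + (t C i)))

  altSum-suc-zero-term : ∀ n c t s → term n c t (suc s) ≡ 0ℤ → altSum n c b t (suc s) ≡ altSum n c b t s
  altSum-suc-zero-term n c t s vanish =
    trans (cong (ℤ._+_ (altSum n c b t s)) vanish) (ℤ.+-identityʳ (altSum n c b t s))

  partial-beyond : ∀ n c t → partial n c t (suc t) ≡ hitting n c t
  partial-beyond n c t =
    cong (ℤ._+_ (+ (n C c))) (altSum-suc-zero-term n c t t (term-beyond n c t (n<1+n t)))

  hitting-suc : ∀ n c t → hitting n c (suc t) ≡ hitting n c t ℤ.- hitting (n ∸ b) c t
  hitting-suc n c t = trans (partial-suc n c t t) (cong (ℤ._- hitting (n ∸ b) c t) (partial-beyond n c t))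

  term-pascal : ∀ n c t i →
    term n (suc c) t i ℤ.+ term n (suc (suc c)) t i ≡ term (suc n) (suc (suc c)) t i
  term-pascal n c t i = begin
    u ℤ.* + X ℤ.+ u ℤ.* + Y     ≡⟨ ℤ.*-distribˡ-+ u (+ X) (+ Y) ⟨
    u ℤ.* (+ X ℤ.+ + Y)        ≡⟨ cong (u ℤ.*_) (pos-+ X Y) ⟨
    u ℤ.* + (X + Y)            ≡⟨ cong (λ k → u ℤ.* + k) (pascal-∸ n (i * b) c) ⟩
    term (suc n) (suc (suc c)) t i ∎
    where
    open ≡-Reasoning
    u = (-1ℤ ℤ.^ i) ℤ.* + (t C i)
    X = (n ∸ i * b) C suc c
    Y = (n ∸ i * b) C suc (suc c)

  altSum-pascal : ∀ n c t s →
    altSum n (suc c) b t s ℤ.+ altSum n (suc (suc c)) b t s ≡ altSum (suc n) (suc (suc c)) b t s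
  altSum-pascal n c t zero    = refl
  altSum-pascal n c t (suc s) =
    trans (interchange (altSum n (suc c) b t s) (term n (suc c) t (suc s))
                       (altSum n (suc (suc c)) b t s) (term n (suc (suc c)) t (suc s)))
          (cong₂ ℤ._+_ (altSum-pascal n c t s) (term-pascal n c t (suc s)))

  hitting-pascal : ∀ n c t →
    hitting n (suc c) t ℤ.+ hitting n (suc (suc c)) t ≡ hitting (suc n) (suc (suc c)) t
  hitting-pascal n c t =
    trans (interchange (+ (n C suc c)) (altSum n (suc c) b t t)
                       (+ (n C suc (suc c))) (altSum n (suc (suc c)) b t t))
          (cong₂ ℤ._+_ (+nCk+nC[k+1]≡+[n+1]C[k+1] n (suc c)) (altSum-pascal n c t t))

  altSum-stable : ∀ n c t {k s} → n ∸ b ∸ k * b < c → k ≤′ s → altSum n c b t s ≡ altSum n c b t k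
  altSum-stable n c t small ≤′-refl = refl
  altSum-stable n c t {k} {suc s} small (≤′-step k≤s) =
    trans (altSum-suc-zero-term n c t s (term-small n c t (suc s) (≤-<-trans smaller small)))
          (altSum-stable n c t small k≤s)
    where
    smaller : n ∸ suc s * b ≤ n ∸ b ∸ k * b
    smaller = ≤-trans (≤-reflexive (sym (∸-+-assoc n b (s * b))))
                      (∸-monoʳ-≤ (n ∸ b) (*-monoˡ-≤ b (≤′⇒≤ k≤s)))

  hitting-small : ∀ n c t → n ∸ b < c → hitting n c t ≡ + (n C c)
  hitting-small n c t small =
    trans (cong (ℤ._+_ (+ (n C c))) (altSum-stable n c t {s = t} small z≤′n)) (ℤ.+-identityʳ (+ (n C c)))

  hitting-zero : ∀ n c → hitting n c 0 ≡ + (n C c)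
  hitting-zero n c = cong +_ (+-identityʳ (n C c))

  hitting-1-1 : ∀ n → hitting n 1 1 ≡ + (b ⊓ n)
  hitting-1-1 n = begin
    hitting n 1 1                          ≡⟨ hitting-suc n 1 0 ⟩
    hitting n 1 0 ℤ.- hitting (n ∸ b) 1 0  ≡⟨ cong₂ ℤ._-_ (hitting-1-0 n) (hitting-1-0 (n ∸ b)) ⟩
    + n ℤ.- + (n ∸ b)                      ≡⟨ cong (λ m → + m ℤ.- + (n ∸ b)) (m⊓n+n∸m≡n b n) ⟨
    + (b ⊓ n + (n ∸ b)) ℤ.- + (n ∸ b)      ≡⟨ cong (ℤ._- + (n ∸ b)) (pos-+ (b ⊓ n) (n ∸ b)) ⟩
    + (b ⊓ n) ℤ.+ + (n ∸ b) ℤ.- + (n ∸ b)  ≡⟨ //-rightDividesʳ (+ (n ∸ b)) (+ (b ⊓ n)) ⟩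
    + (b ⊓ n)                              ∎
    where
    open ≡-Reasoning
    hitting-1-0 : ∀ m → hitting m 1 0 ≡ + m
    hitting-1-0 m = trans (hitting-zero m 1) (cong +_ (nC1≡n m))

  Monotone : ℕ → ℕ → Set
  Monotone c t = ∀ n → hitting n c t ℤ.≤ hitting (suc n) c t

  monotone-≤′ : ∀ {c t} → Monotone c t → ∀ {m n} → m ≤′ n → hitting m c t ℤ.≤ hitting n c t
  monotone-≤′ mono ≤′-refl               = ℤ.≤-refl
  monotone-≤′ {c} {t} mono (≤′-step m≤n) = ℤ.≤-trans (monotone-≤′ {c} {t} mono m≤n) (mono _)

  hitting-nonneg : ∀ {c t} → Monotone c t → ∀ n → 0ℤ ℤ.≤ hitting n c (suc t)
  hitting-nonneg {c} {t} mono n =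
    subst (0ℤ ℤ.≤_) (sym (hitting-suc n c t))
          (ℤ.i≤j⇒0≤j-i (monotone-≤′ {c} {t} mono (≤⇒≤′ (m∸n≤m n b))))

  -- Pascal's rule turns the increment in n into hitting n (c - 1) t ≥ 0; it fails for c = 1
  -- (truncated subtraction), so (c, t) = (1, 1) is computed directly.
  monotone : ∀ {c t} → t ≤ c → Monotone c t
  monotone {c}           {zero}        _         n =
    subst₂ ℤ._≤_ (sym (hitting-zero n c)) (sym (hitting-zero (suc n) c)) (+≤+ (nCk≤[1+n]Ck n c))
  monotone {suc zero}    {suc zero}    _         n =
    subst₂ ℤ._≤_ (sym (hitting-1-1 n)) (sym (hitting-1-1 (suc n))) (+≤+ (⊓-monoʳ-≤ b (n≤1+n n)))
  monotone {suc zero}    {suc (suc t)} (s≤s ()) n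
  monotone {suc (suc c)} {suc t}       (s≤s t≤c) n =
    subst (hitting n (suc (suc c)) (suc t) ℤ.≤_) (hitting-pascal n c (suc t))
      (ℤ.i≤j+i (hitting n (suc (suc c)) (suc t)) (hitting n (suc c) (suc t))
        {{nonNegative (hitting-nonneg {suc c} {t} (monotone t≤c) n)}})

  binomial≤hitting : ∀ {t d c} → 1 ≤ t → d < b → d + t ≤ c → ∀ n → c + d ≤′ n →
                     + (n C d) ℤ.≤ hitting n c t
  binomial≤hitting {t} {d} {c} 1≤t d<b d+t≤c .(c + d) ≤′-refl =
    ℤ.≤-reflexive (trans (cong +_ ([m+n]Cn≡[m+n]Cm c d)) (sym (hitting-small (c + d) c t (m+n∸o<m c {{c≢0}} d<b))))
    where
    c≢0 : NonZero c
    c≢0 = >-nonZero (0<t⇒d+t≤c⇒0<c 1≤t d+t≤c)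
  binomial≤hitting {t} {zero} {c} 1≤t d<b t≤c (suc n) (≤′-step c≤n) =
    ℤ.≤-trans (binomial≤hitting 1≤t d<b t≤c n c≤n) (monotone t≤c n)
  binomial≤hitting {t} {suc d} {zero}    _   _ () _ _
  binomial≤hitting {t} {suc d} {suc zero} 1≤t _ (s≤s d+t≤0) _ _ =
    contradiction (0<t⇒d+t≤c⇒0<c 1≤t d+t≤0) λ ()
  binomial≤hitting {t} {suc d} {suc (suc c)} 1≤t 1+d<b (s≤s d+t≤1+c) (suc n) (≤′-step 2+c+1+d≤n) =
    subst₂ ℤ._≤_ (+nCk+nC[k+1]≡+[n+1]C[k+1] n d) (hitting-pascal n c t)
      (ℤ.+-mono-≤ (binomial≤hitting 1≤t (<⇒≤ 1+d<b) d+t≤1+c n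
                                    (≤′-trans (m+n≤′[1+m]+[1+n] (suc c) d) 2+c+1+d≤n))
                  (binomial≤hitting 1≤t 1+d<b (s≤s d+t≤1+c) n 2+c+1+d≤n))

module _ (b : ℕ) where
  open Hitting (suc b)

  hitting-at : ∀ {c t} → 1 ≤ c → 1 ≤ t → hitting (c + suc b) c t ≡ + ((c + suc b) C c) ℤ.- + t
  hitting-at {c} {suc t} 1≤c _ =
    cong (ℤ._+_ (+ (n C c))) (trans (altSum-stable n c (suc t) {s = suc t} small (s≤′s z≤′n)) first-term)
    where
    open ≡-Reasoning
    n = c + suc b
    n∸b≡c : n ∸ 1 * suc b ≡ c
    n∸b≡c = trans (cong (n ∸_) (*-identityˡ (suc b))) (m+n∸n≡m c (suc b))
    small : n ∸ suc b ∸ 1 * suc b < c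
    small = subst (λ m → m ∸ 1 * suc b < c) (sym (m+n∸n≡m c (suc b)))
                  (m<n+o⇒m∸n<o c (1 * suc b) {{>-nonZero 1≤c}} (m<n+m c z<s))
    negate : ∀ x → 0ℤ ℤ.+ (-1ℤ ℤ.* ℤ.1ℤ) ℤ.* x ℤ.* ℤ.1ℤ ≡ ℤ.- x
    negate = solve-∀
    first-term : altSum n c (suc b) (suc t) 1 ≡ ℤ.- + suc t
    first-term = begin
      0ℤ ℤ.+ (-1ℤ ℤ.^ 1) ℤ.* + (suc t C 1) ℤ.* + ((n ∸ 1 * suc b) C c)
        ≡⟨ cong₂ (λ p k → 0ℤ ℤ.+ (-1ℤ ℤ.^ 1) ℤ.* + p ℤ.* + k)
                 (nC1≡n (suc t)) (trans (cong (_C c) n∸b≡c) (nCn≡1 c)) ⟩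
      0ℤ ℤ.+ (-1ℤ ℤ.^ 1) ℤ.* + suc t ℤ.* ℤ.1ℤ
        ≡⟨ negate (+ suc t) ⟩
      ℤ.- + suc t ∎

  binomial≤hitting+t : ∀ {t a} → 1 ≤ t → suc b + t ≤ a → ∀ n → a + suc b ≤′ n →
                       + (n C suc b) ℤ.≤ hitting n a t ℤ.+ + t
  binomial≤hitting+t {t} {a} 1≤t 1+b+t≤a .(a + suc b) ≤′-refl = ℤ.≤-reflexive (begin
    + ((a + suc b) C suc b)                ≡⟨ cong +_ ([m+n]Cn≡[m+n]Cm a (suc b)) ⟩
    + ((a + suc b) C a)                    ≡⟨ //-rightDividesˡ (+ t) (+ ((a + suc b) C a)) ⟨
    + ((a + suc b) C a) ℤ.- + t ℤ.+ + t    ≡⟨ cong (ℤ._+ + t) (hitting-at (≤-trans (s≤s z≤n) 1+b+t≤a) 1≤t) ⟨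
    hitting (a + suc b) a t ℤ.+ + t        ∎)
    where open ≡-Reasoning
  binomial≤hitting+t {t} {zero}        _   ()              _       _
  binomial≤hitting+t {t} {suc zero}    1≤t (s≤s b+t≤0)     _       _ =
    contradiction (0<t⇒d+t≤c⇒0<c 1≤t b+t≤0) λ ()
  binomial≤hitting+t {t} {suc (suc a)} 1≤t (s≤s b+t≤1+a) (suc n) (≤′-step 2+a+1+b≤n) =
    subst₂ ℤ._≤_ (+nCk+nC[k+1]≡+[n+1]C[k+1] n b) regroup
      (ℤ.+-mono-≤ (binomial≤hitting 1≤t (n<1+n b) b+t≤1+a n
                                    (≤′-trans (m+n≤′[1+m]+[1+n] (suc a) b) 2+a+1+b≤n))
                  (binomial≤hitting+t 1≤t (s≤s b+t≤1+a) n 2+a+1+b≤n))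
    where
    regroup : hitting n (suc a) t ℤ.+ (hitting n (suc (suc a)) t ℤ.+ + t)
              ≡ hitting (suc n) (suc (suc a)) t ℤ.+ + t
    regroup = trans (sym (ℤ.+-assoc (hitting n (suc a) t) (hitting n (suc (suc a)) t) (+ t)))
                    (cong (ℤ._+ + t) (hitting-pascal n a t))

slice : ∀ {n} → Bool → Family (suc n) → Family n
slice x [] = []
slice x ((y ∷ F) ∷ 𝓕) with x ≟ y
... | yes _ = F ∷ slice x 𝓕
... | no _  = slice x 𝓕

slice-∉ : ∀ {n x} {F : Subset n} (𝓕 : Family (suc n)) → All ((x ∷ F) ≢_) 𝓕 → All (F ≢_) (slice x 𝓕)
slice-∉ []            []         = []
slice-∉ {x = x} ((y ∷ G) ∷ 𝓕) (F≢G ∷ ps) with x ≟ y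
... | yes refl = (λ F≡G → F≢G (cong (x ∷_) F≡G)) ∷ slice-∉ 𝓕 ps
... | no _     = slice-∉ 𝓕 ps

slice-unique : ∀ {n x} (𝓕 : Family (suc n)) → Unique 𝓕 → Unique (slice x 𝓕)
slice-unique []            []         = []
slice-unique {x = x} ((y ∷ F) ∷ 𝓕) (F∉ ∷ u) with x ≟ y
... | yes refl = slice-∉ 𝓕 F∉ ∷ slice-unique 𝓕 u
... | no _     = slice-unique 𝓕 u

slice-uniform : ∀ {n k x} (𝓕 : Family (suc n)) → Uniform k 𝓕 →
                All (λ F → ∣ x ∷ F ∣ ≡ k) (slice x 𝓕)
slice-uniform []            []         = []
slice-uniform {x = x} ((y ∷ F) ∷ 𝓕) (∣F∣ ∷ s) with x ≟ y
... | yes refl = ∣F∣ ∷ slice-uniform 𝓕 s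
... | no _     = slice-uniform 𝓕 s

length-slices : ∀ {n} (𝓕 : Family (suc n)) → length 𝓕 ≡ length (slice true 𝓕) + length (slice false 𝓕)
length-slices []                = refl
length-slices ((true ∷ F) ∷ 𝓕)  = cong suc (length-slices 𝓕)
length-slices ((false ∷ F) ∷ 𝓕) = trans (cong suc (length-slices 𝓕)) (sym (+-suc _ _))

length-uniform : ∀ {n k} (𝓕 : Family n) → Unique 𝓕 → Uniform k 𝓕 → length 𝓕 ≤ n C k
length-uniform {zero}          []                  _                _          = z≤n
length-uniform {zero}          ([] ∷ [])           _                (refl ∷ _) = ≤-refl
length-uniform {zero}          ([] ∷ [] ∷ _)       ((≢[] ∷ _) ∷ _)  _          = contradiction refl ≢[]
length-uniform {suc n} {zero}  𝓕 u s = begin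
  length 𝓕
    ≡⟨ length-slices 𝓕 ⟩
  length (slice true 𝓕) + length (slice false 𝓕)
    ≡⟨ cong (_+ length (slice false 𝓕)) (no-members (slice-uniform 𝓕 s)) ⟩
  length (slice false 𝓕)
    ≤⟨ length-uniform (slice false 𝓕) (slice-unique 𝓕 u) (slice-uniform 𝓕 s) ⟩
  1 ∎
  where
  open ≤-Reasoning
  no-members : ∀ {𝓖 : Family n} → All (λ F → suc ∣ F ∣ ≡ 0) 𝓖 → length 𝓖 ≡ 0
  no-members []      = refl
  no-members (() ∷ _)
length-uniform {suc n} {suc k} 𝓕 u s =
  subst₂ _≤_ (sym (length-slices 𝓕)) (nCk+nC[k+1]≡[n+1]C[k+1] n k)
    (+-mono-≤ (length-uniform (slice true 𝓕) (slice-unique 𝓕 u)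
                              (All.map suc-injective (slice-uniform 𝓕 s)))
              (length-uniform (slice false 𝓕) (slice-unique 𝓕 u) (slice-uniform 𝓕 s)))

lemma4 : (n a b t : ℕ) → 1 ≤ n → 1 ≤ a → 1 ≤ b → t ≥ 2 → a ≥ b + t → n ≥ a + b →
    (𝓕 𝓖 : Family n) → Unique 𝓕 → Unique 𝓖 → Uniform a 𝓕 → Uniform b 𝓖 →
    CrossIntersecting 𝓕 𝓖 → CoverNumberAtLeast t 𝓖 → 𝓕 ≡ [] →
    (+ (length 𝓕 + length 𝓖)) ℤ.≤ bound n a b t
lemma4 n a (suc b) t _ _ _ 2≤t 1+b+t≤a a+1+b≤n .[] 𝓖 _ 𝓖-unique _ 𝓖-uniform _ _ refl =
  ℤ.≤-trans (+≤+ (length-uniform 𝓖 𝓖-unique 𝓖-uniform))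
            (binomial≤hitting+t b (<⇒≤ 2≤t) 1+b+t≤a n (≤⇒≤′ a+1+b≤n))
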